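{- For every integer $n\ge 4$ and every integer $k$ with $n-2\le k\le n$, the graph $\operatorname{FS}(\mathcal D_n,\mathcal B_{n-k}^{(k)})$ is connected.
   Context: For $n\ge 4$, the snake tongue graph $\mathcal D_n$ is the graph on $n$ vertices obtained from a path on $n-1$ vertices by adding a leaf adjacent to the second-last vertex of the path. For simple graphs $\mathcal G,\mathcal F$ on $n$ vertices, $\operatorname{FS}(\mathcal G,\mathcal F)$ has as vertices the bijections $\sigma:\mathtt V(\mathcal G)\to\mathtt V(\mathcal F)$. Two such bijections $\sigma,\sigma'$ are adjacent iff there is an edge $\{A,B\}$ of $\mathcal G$ such that $\{\sigma(A),\sigma(B)\}\in E(\mathcal F)$, $\sigma'(A)=\sigma(B)$, $\sigma'(B)=\sigma(A)$, and $\sigma'=\sigma$ elsewhere. For $1\le k\le n$, $\mathcal B_{n-k}^{(k)}$ is the graph on $n$ vertices with $k$ vertices adjacent to all other vertices and the remaining $n-k$ vertices pairwise non-adjacent. For $k\le n-1$ this is $n-k$ copies of $\mathcal K_{k+1}$ glued along a common $\mathcal K_k$. -}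

module Defs where

open import Level using (0ℓ)
open import Data.Nat using (ℕ; suc; _+_; _∸_; _<_; _≤_)
open import Data.Fin using (Fin; toℕ)
open import Data.Fin.Permutation using (Permutation′; _⟨$⟩ʳ_)
open import Data.Product using (Σ; _×_; ∃; ∃-syntax)
open import Data.Sum using (_⊎_)
open import Relation.Binary.PropositionalEquality using (_≡_; _≢_)
open import Relation.Binary.Construct.Closure.ReflexiveTransitive using (Star)


-- Snake tongue D_n (n ≥ 4): path 0 - 1 - ... - (n-2), plus leaf (n-1) adjacent to (n-3).
-- Edge relation (unordered) on naturals:
DEdge : ℕ → ℕ → ℕ → Set
DEdge n i j = (suc i ≡ j × j ≤ n ∸ 2) ⊎ (i ≡ n ∸ 3 × j ≡ n ∸ 1)

DAdj : (n : ℕ) → Fin n → Fin n → Set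
DAdj n x y = DEdge n (toℕ x) (toℕ y) ⊎ DEdge n (toℕ y) (toℕ x)

BAdj : (n k : ℕ) → Fin n → Fin n → Set
BAdj n k x y = x ≢ y × (toℕ x < k ⊎ toℕ y < k)

FSAdj : {n : ℕ} → (G F : Fin n → Fin n → Set) →
        Permutation′ n → Permutation′ n → Set
FSAdj {n} G F σ σ′ =
  Σ (Fin n) λ A → Σ (Fin n) λ B →
    G A B × F (σ ⟨$⟩ʳ A) (σ ⟨$⟩ʳ B) ×
    (σ′ ⟨$⟩ʳ A ≡ σ ⟨$⟩ʳ B) × (σ′ ⟨$⟩ʳ B ≡ σ ⟨$⟩ʳ A) ×
    (∀ X → X ≢ A → X ≢ B → σ′ ⟨$⟩ʳ X ≡ σ ⟨$⟩ʳ X)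

FSConnected : {n : ℕ} → (G F : Fin n → Fin n → Set) → Set
FSConnected {n} G F = ∀ (σ τ : Permutation′ n) → Star (FSAdj G F) σ τ

-- Call positions a and b exchangeable when every bijection σ is joined to σ with the values
-- at a and b exchanged. Since k ≥ n - 2, at most two values are bad (≥ k, hence pairwise
-- non-adjacent in B), so among any three positions one carries a good value, and an edge of
-- D_n can be used whenever one of its ends carries a good value. On the claw formed by the
-- vertex n - 3 and its neighbours n - 4, n - 2, n - 1, a fixed sequence of nine moves
-- exchanges the centre with a leaf even when both carry bad values. Exchangeability passes
-- from an edge bc of the path to the adjacent edge ab, and is transitive by conjugation,
-- so every transposition is realised; transpositions generate all bijections.
module Submission where

open import Defs
open import Data.Empty using (⊥; ⊥-elim)
open import Data.Fin using (Fin; toℕ; fromℕ<)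
open import Data.Fin.Patterns using (0F; 1F; 2F; 3F)
open import Data.Fin.Permutation
  using (Permutation′; _⟨$⟩ʳ_; _∘ₚ_; _≈_; transpose; flip; inverseʳ)
import Data.Fin.Permutation.Components as PC
open import Data.Fin.Permutation.Transposition.List
  using (TranspositionList; eval; decompose; eval-decompose)
open import Data.Fin.Properties using (_≟_; toℕ-injective; toℕ-fromℕ<; toℕ<n; any?)
import Data.List.Base as List
open import Data.Nat using (ℕ; zero; suc; _+_; _∸_; _≤_; _<_; z≤n; s≤s; _<?_; _≤?_)
open import Data.Nat.Properties
  using (≤-refl; ≤-trans; ≤-antisym; ≤-pred; ≤-reflexive; ≮⇒≥; ≰⇒>; <⇒≤;
         m≤n⇒m<n∨m≡n; m≤n⇒m≤1+n; n≤1+n; m≤m+n; m≤n+m; +-identityʳ; +-suc; m+[n∸m]≡n;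
         1+n≢n; m≢1+n+m)
open import Data.Product using (∃-syntax; _×_; _,_)
open import Data.Sum using (_⊎_; inj₁; inj₂; swap; map)
open import Data.Vec.Functional using ([]; _∷_)
open import Function.Base using (_∘_; _|>′_)
open import Function.Bundles using (Injection)
open import Function.Definitions using (Injective)
open import Function.Properties.Inverse using (↔⇒↣)
open import Relation.Binary.Construct.Closure.ReflexiveTransitive
  using (Star; ε; _◅_; _◅◅_; return)
open import Relation.Binary.PropositionalEquality
  using (_≡_; _≢_; refl; sym; trans; cong; subst; subst₂; _≗_; ≢-sym)
open import Relation.Nullary using (Dec; yes; no; ¬_)
open import Relation.Nullary.Decidable using (dec-true; dec-false)

m≤n⇒n<2+m⇒n≡m∨n≡1+m : ∀ {m n} → m ≤ n → n < 2 + m → n ≡ m ⊎ n ≡ suc m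
m≤n⇒n<2+m⇒n≡m∨n≡1+m m≤n n<2+m with m≤n⇒m<n∨m≡n m≤n
... | inj₂ m≡n = inj₁ (sym m≡n)
... | inj₁ m<n = inj₂ (≤-antisym (≤-pred n<2+m) m<n)

downward-induction : ∀ (P : ℕ → Set) {m} → P m → (∀ {i} → i < m → P (suc i) → P i) →
                     ∀ {i} → i ≤ m → P i
downward-induction P {m} Pm step i≤m = go _ (m+[n∸m]≡n i≤m)
  where
  go : ∀ d {i} → i + d ≡ m → P i
  go zero    {i} i+0≡m   = subst P (trans (sym i+0≡m) (+-identityʳ i)) Pm
  go (suc d) {i} i+1+d≡m = step (≤-trans (m≤m+n (suc i) d) (≤-reflexive 1+i+d≡m)) (go d 1+i+d≡m)
    where
    1+i+d≡m : suc i + d ≡ m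
    1+i+d≡m = trans (sym (+-suc i d)) i+1+d≡m

module _ {n : ℕ} where

  transpose-matchˡ : (i j : Fin n) → PC.transpose i j i ≡ j
  transpose-matchˡ i j rewrite dec-true (i ≟ i) refl = refl

  transpose-matchʳ : (i j : Fin n) → PC.transpose i j j ≡ i
  transpose-matchʳ i j with j ≟ i
  ... | yes j≡i = j≡i
  ... | no _ rewrite dec-true (j ≟ j) refl = refl

  transpose-mismatch : ∀ {i j x : Fin n} → x ≢ i → x ≢ j → PC.transpose i j x ≡ x
  transpose-mismatch {i} {j} {x} x≢i x≢j
    rewrite dec-false (x ≟ i) x≢i | dec-false (x ≟ j) x≢j = refl

  transpose-same : (i x : Fin n) → PC.transpose i i x ≡ x
  transpose-same i x = by-cases (x ≟ i)
    where
    by-cases : Dec (x ≡ i) → PC.transpose i i x ≡ x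
    by-cases (yes refl) = transpose-matchˡ x x
    by-cases (no x≢i)   = transpose-mismatch x≢i x≢i

  transpose-comm : (i j x : Fin n) → PC.transpose i j x ≡ PC.transpose j i x
  transpose-comm i j x = by-cases (x ≟ i) (x ≟ j)
    where
    by-cases : Dec (x ≡ i) → Dec (x ≡ j) → PC.transpose i j x ≡ PC.transpose j i x
    by-cases (yes refl) (yes refl) = refl
    by-cases (yes refl) (no x≢j)   = trans (transpose-matchˡ x j) (sym (transpose-matchʳ j x))
    by-cases (no x≢i)   (yes refl) = trans (transpose-matchʳ i x) (sym (transpose-matchˡ x i))
    by-cases (no x≢i)   (no x≢j)   =
      trans (transpose-mismatch x≢i x≢j) (sym (transpose-mismatch x≢j x≢i))

transpose-natural : ∀ {m n} {f : Fin m → Fin n} → Injective _≡_ _≡_ f →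
                    ∀ i j x → PC.transpose (f i) (f j) (f x) ≡ f (PC.transpose i j x)
transpose-natural {f = f} f-inj i j x = by-cases (x ≟ i) (x ≟ j)
  where
  by-cases : Dec (x ≡ i) → Dec (x ≡ j) →
             PC.transpose (f i) (f j) (f x) ≡ f (PC.transpose i j x)
  by-cases (yes refl) _ =
    trans (transpose-matchˡ (f x) (f j)) (cong f (sym (transpose-matchˡ x j)))
  by-cases (no x≢i) (yes refl) =
    trans (transpose-matchʳ (f i) (f x)) (cong f (sym (transpose-matchʳ i x)))
  by-cases (no x≢i) (no x≢j) =
    trans (transpose-mismatch (x≢i ∘ f-inj) (x≢j ∘ f-inj))
          (cong f (sym (transpose-mismatch x≢i x≢j)))

∷-injective : ∀ {m n} {x : Fin n} {f : Fin m → Fin n} →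
              (∀ i → x ≢ f i) → Injective _≡_ _≡_ f → Injective _≡_ _≡_ (x ∷ f)
∷-injective x∉f f-inj {Fin.zero}  {Fin.zero}  _  = refl
∷-injective x∉f f-inj {Fin.zero}  {Fin.suc j} eq = ⊥-elim (x∉f j eq)
∷-injective x∉f f-inj {Fin.suc i} {Fin.zero}  eq = ⊥-elim (x∉f i (sym eq))
∷-injective x∉f f-inj {Fin.suc i} {Fin.suc j} eq = cong Fin.suc (f-inj eq)

[]-injective : ∀ {n} → Injective _≡_ _≡_ ([] {A = Fin n})
[]-injective {x = ()}

distinct₃-injective : ∀ {n} {a b c : Fin n} → a ≢ b → a ≢ c → b ≢ c →
                      Injective _≡_ _≡_ (a ∷ b ∷ c ∷ [])
distinct₃-injective a≢b a≢c b≢c =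
  ∷-injective (λ { 0F → a≢b ; 1F → a≢c })
    (∷-injective (λ { 0F → b≢c }) (∷-injective (λ ()) []-injective))

module _ {N : ℕ} where

  ⟨$⟩ʳ-injective : (σ : Permutation′ N) → Injective _≡_ _≡_ (σ ⟨$⟩ʳ_)
  ⟨$⟩ʳ-injective σ = Injection.injective (↔⇒↣ σ)

  exchange : Fin N → Fin N → Permutation′ N → Permutation′ N
  exchange a b σ = transpose a b ∘ₚ σ

  record Patch {m} (σ : Permutation′ N) (ps vs : Fin m → Fin N) (σ′ : Permutation′ N) : Set where
    field
      at  : ∀ i → σ′ ⟨$⟩ʳ ps i ≡ vs i
      off : ∀ x → (∀ i → x ≢ ps i) → σ′ ⟨$⟩ʳ x ≡ σ ⟨$⟩ʳ x

  open Patch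

  module _ {m} {σ : Permutation′ N} {ps : Fin m → Fin N} where

    patch-refl : Patch σ ps (λ i → σ ⟨$⟩ʳ ps i) σ
    patch-refl = record { at = λ _ → refl ; off = λ _ _ → refl }

    patch-exchange : Injective _≡_ _≡_ ps → ∀ i j {vs σ′} → Patch σ ps vs σ′ →
                     Patch σ ps (vs ∘ PC.transpose i j) (exchange (ps i) (ps j) σ′)
    patch-exchange ps-inj i j {σ′ = σ′} p = record
      { at  = λ l → trans (cong (σ′ ⟨$⟩ʳ_) (transpose-natural ps-inj i j l)) (at p _)
      ; off = λ x x∉ps →
          trans (cong (σ′ ⟨$⟩ʳ_) (transpose-mismatch (x∉ps i) (x∉ps j))) (off p x x∉ps)
      }

    patch-resp-≈ : ∀ {vs σ′ σ″} → σ′ ≈ σ″ → Patch σ ps vs σ′ → Patch σ ps vs σ″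
    patch-resp-≈ σ′≈σ″ p = record
      { at  = λ i → trans (sym (σ′≈σ″ _)) (at p i)
      ; off = λ x x∉ps → trans (sym (σ′≈σ″ x)) (off p x x∉ps)
      }

    patch-unique : ∀ {vs ws σ₁ σ₂} → vs ≗ ws → Patch σ ps vs σ₁ → Patch σ ps ws σ₂ → σ₁ ≈ σ₂
    patch-unique vs≗ws p₁ p₂ x with any? (λ i → x ≟ ps i)
    ... | yes (i , refl) = trans (at p₁ i) (trans (vs≗ws i) (sym (at p₂ i)))
    ... | no  x∉ps       = trans (off p₁ x x∉ps′) (sym (off p₂ x x∉ps′))
      where
      x∉ps′ : ∀ i → x ≢ ps i
      x∉ps′ i x≡psi = x∉ps (i , x≡psi)

module FriendsAndStrangers (N k : ℕ)
                           (G : Fin N → Fin N → Set) (G-irrefl : ∀ {a b} → G a b → a ≢ b) where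

  Perm : Set
  Perm = Permutation′ N

  Adj : Perm → Perm → Set
  Adj = FSAdj G (BAdj N k)

  good : Fin N → Set
  good v = toℕ v < k

  good? : ∀ v → Dec (good v)
  good? v = toℕ v <? k

  exchange-adj : ∀ {a b} σ → G a b → good (σ ⟨$⟩ʳ a) ⊎ good (σ ⟨$⟩ʳ b) →
                 Adj σ (exchange a b σ)
  exchange-adj {a} {b} σ gab good-ab =
    a , b , gab , (G-irrefl gab ∘ ⟨$⟩ʳ-injective σ , good-ab) ,
    cong (σ ⟨$⟩ʳ_) (transpose-matchˡ a b) , cong (σ ⟨$⟩ʳ_) (transpose-matchʳ a b) ,
    λ x x≢a x≢b → cong (σ ⟨$⟩ʳ_) (transpose-mismatch x≢a x≢b)

  adj-resp-≈ : ∀ {σ σ′ τ τ′} → σ ≈ σ′ → τ ≈ τ′ → Adj σ τ → Adj σ′ τ′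
  adj-resp-≈ σ≈σ′ τ≈τ′ (a , b , gab , fab , τa , τb , τx) =
    a , b , gab , subst₂ (BAdj N k) (σ≈σ′ a) (σ≈σ′ b) fab ,
    trans (sym (τ≈τ′ a)) (trans τa (σ≈σ′ b)) , trans (sym (τ≈τ′ b)) (trans τb (σ≈σ′ a)) ,
    λ x x≢a x≢b → trans (sym (τ≈τ′ x)) (trans (τx x x≢a x≢b) (σ≈σ′ x))

  adj-sym : ∀ {σ τ} → Adj σ τ → Adj τ σ
  adj-sym (a , b , gab , (σa≢σb , good-ab) , τa , τb , τx) =
    a , b , gab , subst₂ (BAdj N k) (sym τa) (sym τb) (≢-sym σa≢σb , swap good-ab) ,
    sym τb , sym τa , λ x x≢a x≢b → sym (τx x x≢a x≢b)

  -- Composites of permutations are only pointwise equal to the expected ones, hence walks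
  -- are only required to end at a permutation ≈ the target.
  record Reachable (σ τ : Perm) : Set where
    constructor reach
    field
      {end} : Perm
      walk  : Star Adj σ end
      end≈  : end ≈ τ

  reachable-≈ : ∀ {σ τ} → σ ≈ τ → Reachable σ τ
  reachable-≈ σ≈τ = reach ε σ≈τ

  reachable-respʳ-≈ : ∀ {σ τ τ′} → τ ≈ τ′ → Reachable σ τ → Reachable σ τ′
  reachable-respʳ-≈ τ≈τ′ (reach σ⇝ρ ρ≈τ) = reach σ⇝ρ λ x → trans (ρ≈τ x) (τ≈τ′ x)

  reachable-respˡ-≈ : ∀ {σ σ′ τ} → σ′ ≈ σ → Reachable σ τ → Reachable σ′ τ
  reachable-respˡ-≈ σ′≈σ (reach ε σ≈τ) = reach ε λ x → trans (σ′≈σ x) (σ≈τ x)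
  reachable-respˡ-≈ {σ} {σ′} σ′≈σ (reach (_◅_ {j = ρ} σ~ρ ρ⇝υ) υ≈τ) =
    reach (adj-resp-≈ {σ} {σ′} {ρ} {ρ} (sym ∘ σ′≈σ) (λ _ → refl) σ~ρ ◅ ρ⇝υ) υ≈τ

  reachable-trans : ∀ {σ τ υ} → Reachable σ τ → Reachable τ υ → Reachable σ υ
  reachable-trans (reach σ⇝ρ ρ≈τ) τ⇝υ with reachable-respˡ-≈ ρ≈τ τ⇝υ
  ... | reach ρ⇝ρ′ ρ′≈υ = reach (σ⇝ρ ◅◅ ρ⇝ρ′) ρ′≈υ

  exchange-reachable : ∀ {a b} σ → G a b → good (σ ⟨$⟩ʳ a) ⊎ good (σ ⟨$⟩ʳ b) →
                       Reachable σ (exchange a b σ)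
  exchange-reachable {a} {b} σ gab good-ab =
    reach {end = exchange a b σ} (return (exchange-adj σ gab good-ab)) λ _ → refl

  Exchangeable : Fin N → Fin N → Set
  Exchangeable a b = ∀ σ → Reachable σ (exchange a b σ)

  exchangeable-refl : ∀ a → Exchangeable a a
  exchangeable-refl a σ = reachable-≈ λ x → cong (σ ⟨$⟩ʳ_) (sym (transpose-same a x))

  exchangeable-sym : ∀ {a b} → Exchangeable a b → Exchangeable b a
  exchangeable-sym {a} {b} a⇄b σ =
    reachable-respʳ-≈ (λ x → cong (σ ⟨$⟩ʳ_) (transpose-comm a b x)) (a⇄b σ)

  Reaches : ∀ {m} → Perm → (ps vs : Fin m → Fin N) → Set
  Reaches σ ps vs = ∃[ σ′ ] Star Adj σ σ′ × Patch σ ps vs σ′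

  module _ {m} {σ : Perm} {ps : Fin m → Fin N} (ps-inj : Injective _≡_ _≡_ ps) where

    reaches-start : Reaches σ ps (λ i → σ ⟨$⟩ʳ ps i)
    reaches-start = σ , ε , patch-refl

    reaches-edge : ∀ i j {vs} → G (ps i) (ps j) → good (vs i) ⊎ good (vs j) →
                   Reaches σ ps vs → Reaches σ ps (vs ∘ PC.transpose i j)
    reaches-edge i j gij good-ij (σ′ , σ⇝σ′ , p) =
      exchange (ps i) (ps j) σ′ ,
      σ⇝σ′ ◅◅ return (exchange-adj σ′ gij (map (subst good (sym (Patch.at p i)))
                                               (subst good (sym (Patch.at p j))) good-ij)) ,
      patch-exchange ps-inj i j p

    reaches-exchange : ∀ i j {vs} → Exchangeable (ps i) (ps j) →
                       Reaches σ ps vs → Reaches σ ps (vs ∘ PC.transpose i j)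
    reaches-exchange i j i⇄j (σ′ , σ⇝σ′ , p) with i⇄j σ′
    ... | reach {ρ} σ′⇝ρ ρ≈ =
      ρ , σ⇝σ′ ◅◅ σ′⇝ρ , patch-resp-≈ (sym ∘ ρ≈) (patch-exchange ps-inj i j p)

    reaches⇒reachable : ∀ {vs ws τ} → vs ≗ ws → Patch σ ps ws τ →
                        Reaches σ ps vs → Reachable σ τ
    reaches⇒reachable vs≗ws p (σ′ , σ⇝σ′ , p′) = reach σ⇝σ′ (patch-unique vs≗ws p′ p)

  exchangeable-trans : ∀ {a b c} → Exchangeable a b → Exchangeable b c → Exchangeable a c
  exchangeable-trans {a} {b} {c} a⇄b b⇄c with a ≟ b | b ≟ c | a ≟ c
  ... | yes refl | _        | _        = b⇄c
  ... | no _     | yes refl | _        = a⇄b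
  ... | no _     | no _     | yes refl = exchangeable-refl a
  ... | no a≢b   | no b≢c   | no a≢c   = λ σ →
    reaches-start inj
      |>′ reaches-exchange inj 0F 1F a⇄b
      |>′ reaches-exchange inj 1F 2F b⇄c
      |>′ reaches-exchange inj 0F 1F a⇄b
      |>′ reaches⇒reachable inj (λ { 0F → refl ; 1F → refl ; 2F → refl })
                                (patch-exchange inj 0F 2F patch-refl)
    where
    inj : Injective _≡_ _≡_ (a ∷ b ∷ c ∷ [])
    inj = distinct₃-injective a≢b a≢c b≢c

  module _ (exchangeable : ∀ a b → Exchangeable a b) where

    reachable-eval : ∀ σ (xs : TranspositionList N) → Reachable σ (eval xs ∘ₚ σ)
    reachable-eval σ List.[]             = reachable-≈ λ _ → refl
    reachable-eval σ ((i , j) List.∷ xs) =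
      reachable-respʳ-≈ (λ _ → refl)
        (reachable-trans (reachable-eval σ xs) (exchangeable i j (eval xs ∘ₚ σ)))

    reachable : ∀ σ τ → Reachable σ τ
    reachable σ τ = reachable-respʳ-≈ eval≈τ (reachable-eval σ (decompose π))
      where
      π : Perm
      π = τ ∘ₚ flip σ
      eval≈τ : eval (decompose π) ∘ₚ σ ≈ τ
      eval≈τ x = trans (cong (σ ⟨$⟩ʳ_) (eval-decompose π x)) (inverseʳ σ)

    connected : (∀ σ → ∃[ τ ] Adj σ τ) → FSConnected G (BAdj N k)
    connected neighbour σ τ with reachable σ τ
    ... | reach {ρ} σ⇝ρ ρ≈τ with neighbour ρ
    ...   | υ , ρ~υ =
      σ⇝ρ ◅◅ _◅_ {j = υ} ρ~υ (return (adj-resp-≈ {υ} {υ} {ρ} {τ} (λ _ → refl) ρ≈τ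
                                                   (adj-sym {ρ} {υ} ρ~υ)))

  module AtMostTwoBad (N≤2+k : N ≤ 2 + k) where

    good-third : ∀ {u v w} → u ≢ v → u ≢ w → v ≢ w → ¬ good u → ¬ good v → good w
    good-third {u} {v} {w} u≢v u≢w v≢w ¬gu ¬gv with good? w
    ... | yes gw  = gw
    ... | no  ¬gw = ⊥-elim (no-third-slot (slot ¬gu) (slot ¬gv) (slot ¬gw)
                              (u≢v ∘ toℕ-injective) (u≢w ∘ toℕ-injective) (v≢w ∘ toℕ-injective))
      where
      slot : ∀ {x} → ¬ good x → toℕ x ≡ k ⊎ toℕ x ≡ suc k
      slot {x} ¬gx = m≤n⇒n<2+m⇒n≡m∨n≡1+m (≮⇒≥ ¬gx) (≤-trans (toℕ<n x) N≤2+k)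
      no-third-slot : ∀ {x y z} → x ≡ k ⊎ x ≡ suc k → y ≡ k ⊎ y ≡ suc k → z ≡ k ⊎ z ≡ suc k →
                      x ≢ y → x ≢ z → y ≢ z → ⊥
      no-third-slot (inj₁ refl) (inj₁ refl) _           x≢y _   _   = x≢y refl
      no-third-slot (inj₂ refl) (inj₂ refl) _           x≢y _   _   = x≢y refl
      no-third-slot (inj₁ refl) (inj₂ refl) (inj₁ refl) _   x≢z _   = x≢z refl
      no-third-slot (inj₁ refl) (inj₂ refl) (inj₂ refl) _   _   y≢z = y≢z refl
      no-third-slot (inj₂ refl) (inj₁ refl) (inj₁ refl) _   _   y≢z = y≢z refl
      no-third-slot (inj₂ refl) (inj₁ refl) (inj₂ refl) _   x≢z _   = x≢z refl

    good-among : ∀ σ {u v w} → u ≢ v → u ≢ w → v ≢ w →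
                 ¬ good (σ ⟨$⟩ʳ u) → ¬ good (σ ⟨$⟩ʳ v) → good (σ ⟨$⟩ʳ w)
    good-among σ u≢v u≢w v≢w =
      good-third (u≢v ∘ ⟨$⟩ʳ-injective σ) (u≢w ∘ ⟨$⟩ʳ-injective σ) (v≢w ∘ ⟨$⟩ʳ-injective σ)

    -- When the values at a and b are both bad, the good value at c is the go-between.
    exchangeable-propagate : ∀ {a b c} → G a b → G b c → a ≢ c →
                             Exchangeable b c → Exchangeable a b
    exchangeable-propagate {a} {b} {c} gab gbc a≢c b⇄c σ
      with good? (σ ⟨$⟩ʳ a) | good? (σ ⟨$⟩ʳ b)
    ... | yes ga | _      = exchange-reachable σ gab (inj₁ ga)
    ... | no _   | yes gb = exchange-reachable σ gab (inj₂ gb)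
    ... | no ¬ga | no ¬gb =
      reaches-start inj
        |>′ reaches-exchange inj 1F 2F b⇄c
        |>′ reaches-edge inj 0F 1F gab (inj₂ gc)
        |>′ reaches-exchange inj 1F 2F b⇄c
        |>′ reaches-edge inj 0F 1F gab (inj₁ gc)
        |>′ reaches-exchange inj 1F 2F b⇄c
        |>′ reaches⇒reachable inj (λ { 0F → refl ; 1F → refl ; 2F → refl })
                                  (patch-exchange inj 0F 1F patch-refl)
      where
      inj : Injective _≡_ _≡_ (a ∷ b ∷ c ∷ [])
      inj = distinct₃-injective (G-irrefl gab) a≢c (G-irrefl gbc)
      gc : good (σ ⟨$⟩ʳ c)
      gc = good-among σ (G-irrefl gab) a≢c (G-irrefl gbc) ¬ga ¬gb

    -- The bad values start at c and r; the good values of p and q take turns at c.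
    exchangeable-claw : ∀ {c p q r} → G c p → G c q → G c r → p ≢ q → p ≢ r → q ≢ r →
                        Exchangeable c r
    exchangeable-claw {c} {p} {q} {r} gcp gcq gcr p≢q p≢r q≢r σ
      with good? (σ ⟨$⟩ʳ c) | good? (σ ⟨$⟩ʳ r)
    ... | yes gc | _      = exchange-reachable σ gcr (inj₁ gc)
    ... | no _   | yes gr = exchange-reachable σ gcr (inj₂ gr)
    ... | no ¬gc | no ¬gr =
      reaches-start inj
        |>′ reaches-edge inj 0F 2F gcq (inj₂ gq)
        |>′ reaches-edge inj 0F 3F gcr (inj₁ gq)
        |>′ reaches-edge inj 0F 1F gcp (inj₂ gp)
        |>′ reaches-edge inj 0F 2F gcq (inj₁ gp)
        |>′ reaches-edge inj 0F 3F gcr (inj₂ gq)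
        |>′ reaches-edge inj 0F 1F gcp (inj₁ gq)
        |>′ reaches-edge inj 0F 2F gcq (inj₂ gp)
        |>′ reaches-edge inj 0F 1F gcp (inj₁ gp)
        |>′ reaches-edge inj 0F 2F gcq (inj₁ gq)
        |>′ reaches⇒reachable inj (λ { 0F → refl ; 1F → refl ; 2F → refl ; 3F → refl })
                                  (patch-exchange inj 0F 3F patch-refl)
      where
      c≢p : c ≢ p
      c≢p = G-irrefl gcp
      c≢q : c ≢ q
      c≢q = G-irrefl gcq
      c≢r : c ≢ r
      c≢r = G-irrefl gcr
      inj : Injective _≡_ _≡_ (c ∷ p ∷ q ∷ r ∷ [])
      inj = ∷-injective (λ { 0F → c≢p ; 1F → c≢q ; 2F → c≢r }) (distinct₃-injective p≢q p≢r q≢r)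
      gp : good (σ ⟨$⟩ʳ p)
      gp = good-among σ c≢r c≢p (≢-sym p≢r) ¬gc ¬gr
      gq : good (σ ⟨$⟩ʳ q)
      gq = good-among σ c≢r c≢q (≢-sym q≢r) ¬gc ¬gr

    has-neighbour : ∀ {a b c} → G a b → G b c → a ≢ c → ∀ σ → ∃[ τ ] Adj σ τ
    has-neighbour {a} {b} {c} gab gbc a≢c σ with good? (σ ⟨$⟩ʳ a) | good? (σ ⟨$⟩ʳ b)
    ... | yes ga | _      = exchange a b σ , exchange-adj σ gab (inj₁ ga)
    ... | no _   | yes gb = exchange a b σ , exchange-adj σ gab (inj₂ gb)
    ... | no ¬ga | no ¬gb =
      exchange b c σ ,
      exchange-adj σ gbc (inj₂ (good-among σ (G-irrefl gab) a≢c (G-irrefl gbc) ¬ga ¬gb))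

module SnakeTongue (m k : ℕ) (2+m≤k : 2 + m ≤ k) where

  D : Fin (4 + m) → Fin (4 + m) → Set
  D = DAdj (4 + m)

  D-irrefl : ∀ {x y} → D x y → x ≢ y
  D-irrefl (inj₁ x~y) x≡y = DEdge-irrefl x~y (cong toℕ x≡y)
    where
    DEdge-irrefl : ∀ {i j} → DEdge (4 + m) i j → i ≢ j
    DEdge-irrefl (inj₁ (refl , _))    = ≢-sym 1+n≢n
    DEdge-irrefl (inj₂ (refl , refl)) = m≢1+n+m (suc m) {1}
  D-irrefl (inj₂ y~x) x≡y = D-irrefl (inj₁ y~x) (sym x≡y)

  open FriendsAndStrangers (4 + m) k D D-irrefl
  open AtMostTwoBad (s≤s (s≤s 2+m≤k))

  path-edge : ∀ {x y} → toℕ y ≡ suc (toℕ x) → toℕ y ≤ 2 + m → D x y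
  path-edge y≡1+x y≤2+m = inj₁ (inj₁ (sym y≡1+x , y≤2+m))

  vertex : ∀ {i} → i ≤ 3 + m → Fin (4 + m)
  vertex i≤3+m = fromℕ< (s≤s i≤3+m)

  toℕ-vertex : ∀ {i} (i≤3+m : i ≤ 3 + m) → toℕ (vertex i≤3+m) ≡ i
  toℕ-vertex i≤3+m = toℕ-fromℕ< (s≤s i≤3+m)

  ≡-by-toℕ : ∀ {x y : Fin (4 + m)} {i} → toℕ x ≡ i → toℕ y ≡ i → x ≡ y
  ≡-by-toℕ x≡i y≡i = toℕ-injective (trans x≡i (sym y≡i))

  ≢-by-toℕ : ∀ {x y : Fin (4 + m)} {i j} → toℕ x ≡ i → toℕ y ≡ j → i ≢ j → x ≢ y
  ≢-by-toℕ x≡i y≡j i≢j refl = i≢j (trans (sym x≡i) y≡j)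

  centre p q r : Fin (4 + m)
  centre = vertex (m≤n+m (1 + m) 2)
  p      = vertex (m≤n+m m 3)
  q      = vertex (n≤1+n (2 + m))
  r      = vertex (≤-refl {3 + m})

  centre≡1+m : toℕ centre ≡ 1 + m
  centre≡1+m = toℕ-vertex (m≤n+m (1 + m) 2)
  p≡m : toℕ p ≡ m
  p≡m = toℕ-vertex (m≤n+m m 3)
  q≡2+m : toℕ q ≡ 2 + m
  q≡2+m = toℕ-vertex (n≤1+n (2 + m))
  r≡3+m : toℕ r ≡ 3 + m
  r≡3+m = toℕ-vertex (≤-refl {3 + m})

  centre~p : D centre p
  centre~p = swap (path-edge (trans centre≡1+m (cong suc (sym p≡m)))
                             (≤-trans (≤-reflexive centre≡1+m) (n≤1+n (1 + m))))
  centre~q : D centre q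
  centre~q = path-edge (trans q≡2+m (cong suc (sym centre≡1+m))) (≤-reflexive q≡2+m)
  centre~r : D centre r
  centre~r = inj₁ (inj₂ (centre≡1+m , r≡3+m))

  p≢q : p ≢ q
  p≢q = ≢-by-toℕ p≡m q≡2+m (m≢1+n+m m {1})
  p≢r : p ≢ r
  p≢r = ≢-by-toℕ p≡m r≡3+m (m≢1+n+m m {2})
  q≢r : q ≢ r
  q≢r = ≢-by-toℕ q≡2+m r≡3+m (m≢1+n+m (2 + m) {0})

  centre⇄p : Exchangeable centre p
  centre⇄p = exchangeable-claw centre~q centre~r centre~p q≢r (≢-sym p≢q) (≢-sym p≢r)
  centre⇄q : Exchangeable centre q
  centre⇄q = exchangeable-claw centre~p centre~r centre~q p≢r p≢q (≢-sym q≢r)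
  centre⇄r : Exchangeable centre r
  centre⇄r = exchangeable-claw centre~p centre~q centre~r p≢q p≢r q≢r

  path-exchangeable : ∀ {i} → i ≤ m → ∀ {x y} → toℕ x ≡ i → toℕ y ≡ suc i → Exchangeable x y
  path-exchangeable = downward-induction P base step
    where
    P : ℕ → Set
    P i = ∀ {x y} → toℕ x ≡ i → toℕ y ≡ suc i → Exchangeable x y
    base : P m
    base x≡m y≡1+m = subst₂ Exchangeable (≡-by-toℕ p≡m x≡m) (≡-by-toℕ centre≡1+m y≡1+m)
                            (exchangeable-sym centre⇄p)
    step : ∀ {i} → i < m → P (suc i) → P i
    step {i} i<m IH {x} {y} x≡i y≡1+i = exchangeable-propagate x~y y~z x≢z (IH y≡1+i z≡2+i)
      where
      2+i≤2+m : 2 + i ≤ 2 + m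
      2+i≤2+m = s≤s (s≤s (<⇒≤ i<m))
      z : Fin (4 + m)
      z = vertex (m≤n⇒m≤1+n 2+i≤2+m)
      z≡2+i : toℕ z ≡ 2 + i
      z≡2+i = toℕ-vertex (m≤n⇒m≤1+n 2+i≤2+m)
      x~y : D x y
      x~y = path-edge (trans y≡1+i (cong suc (sym x≡i)))
                      (≤-trans (≤-reflexive y≡1+i) (m≤n⇒m≤1+n (m≤n⇒m≤1+n i<m)))
      y~z : D y z
      y~z = path-edge (trans z≡2+i (cong suc (sym y≡1+i))) (≤-trans (≤-reflexive z≡2+i) 2+i≤2+m)
      x≢z : x ≢ z
      x≢z = ≢-by-toℕ x≡i z≡2+i (m≢1+n+m i {1})

  towards-centre : ∀ {i} → i ≤ suc m → ∀ {x} → toℕ x ≡ i → Exchangeable x centre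
  towards-centre = downward-induction P base step
    where
    P : ℕ → Set
    P i = ∀ {x} → toℕ x ≡ i → Exchangeable x centre
    base : P (suc m)
    base x≡1+m = subst (λ x → Exchangeable x centre) (≡-by-toℕ centre≡1+m x≡1+m)
                       (exchangeable-refl centre)
    step : ∀ {i} → i < suc m → P (suc i) → P i
    step {i} i<1+m IH x≡i =
      exchangeable-trans (path-exchangeable (≤-pred i<1+m) x≡i y≡1+i) (IH y≡1+i)
      where
      1+i≤3+m : 1 + i ≤ 3 + m
      1+i≤3+m = m≤n⇒m≤1+n (m≤n⇒m≤1+n i<1+m)
      y : Fin (4 + m)
      y = vertex 1+i≤3+m
      y≡1+i : toℕ y ≡ 1 + i
      y≡1+i = toℕ-vertex 1+i≤3+m

  exchangeable-with-centre : ∀ x → Exchangeable x centre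
  exchangeable-with-centre x with toℕ x ≤? suc m
  ... | yes x≤1+m = towards-centre x≤1+m refl
  ... | no  x≰1+m with m≤n⇒n<2+m⇒n≡m∨n≡1+m (≰⇒> x≰1+m) (toℕ<n x)
  ...   | inj₁ x≡2+m = subst (λ x → Exchangeable x centre) (≡-by-toℕ q≡2+m x≡2+m)
                             (exchangeable-sym centre⇄q)
  ...   | inj₂ x≡3+m = subst (λ x → Exchangeable x centre) (≡-by-toℕ r≡3+m x≡3+m)
                             (exchangeable-sym centre⇄r)

  all-exchangeable : ∀ x y → Exchangeable x y
  all-exchangeable x y =
    exchangeable-trans (exchangeable-with-centre x) (exchangeable-sym (exchangeable-with-centre y))

  snake-connected : FSConnected D (BAdj (4 + m) k)
  snake-connected =
    connected all-exchangeable
      (has-neighbour {0F} {1F} {2F} (path-edge refl (s≤s z≤n)) (path-edge refl (s≤s (s≤s z≤n)))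
                     λ ())

mainTheorem2 : (n k : ℕ) → 4 ≤ n → n ∸ 2 ≤ k → k ≤ n →
    FSConnected (DAdj n) (BAdj n k)
mainTheorem2 (suc (suc (suc (suc m)))) k (s≤s (s≤s (s≤s (s≤s _)))) 2+m≤k _ =
  SnakeTongue.snake-connected m k 2+m≤k
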